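{- Let $a,b$ be integers with $1 \le a \le b$. If $(a,b) \ne (1,1)$, then $(a,b)$ is not regular; that is, there exists $r \in \mathbb{N}$ and an $r$-coloring of $\mathbb{N}$ admitting no monochromatic $(a,b)$-triple.
   Context: For integers $1 \le a \le b$, an $(a,b)$-triple is a triple $(x, ax+d, bx+2d)$ with $x,d$ positive integers. A coloring admits a monochromatic $(a,b)$-triple if all three entries of some $(a,b)$-triple receive the same color. The pair $(a,b)$ is $r$-regular if every $r$-coloring of $\mathbb{N}$ admits a monochromatic $(a,b)$-triple, and regular if it is $r$-regular for every $r\in\mathbb{N}$. -}

module Defs where

open import Data.Nat using (ℕ; _+_; _*_; _≤_; _≥_)
open import Data.Fin using (Fin)
open import Data.Product using (_×_; ∃-syntax)
open import Relation.Binary.PropositionalEquality using (_≡_)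

-- An r-coloring of the positive integers. We colour all of ℕ (including 0);
-- only values at positive arguments ever matter below.
Coloring : ℕ → Set
Coloring r = ℕ → Fin r

MonoTriple : ∀ {r} → ℕ → ℕ → Coloring r → ℕ → ℕ → Set
MonoTriple a b c x d =
  (x ≥ 1) × (d ≥ 1) × (c x ≡ c (a * x + d)) × (c x ≡ c (b * x + 2 * d))

AdmitsMono : ∀ {r} → ℕ → ℕ → Coloring r → Set
AdmitsMono a b c = ∃[ x ] ∃[ d ] MonoTriple a b c x d

Regular-r : ℕ → ℕ → ℕ → Set
Regular-r r a b = (c : Coloring r) → AdmitsMono a b c

Regular : ℕ → ℕ → Set
Regular a b = (r : ℕ) → Regular-r r a b

module Submission where

-- Colour n by its level ⌊log_√2 n⌋ modulo 2k + 1, where 2^k = 2^(b+1) exceeds both b and 2a.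
-- Two numbers of the same colour whose ratio is at least 3/2 (so their levels differ) then
-- have ratio above 2^k. For a monochromatic triple (x, y, z) = (x, ax + d, bx + 2d) this
-- applies to y and z once 2z ≥ 3y, contradicting z ≤ by. If 2a ≤ b then z ≥ 2y outright;
-- otherwise a ≥ 2, so y ≥ 2x, and the same principle gives y > 2^k x ≥ 2ax, whence
-- 2z ≥ 4y − 2ax ≥ 3y.

open import Defs
open import Data.Nat using (ℕ; _≤_)
open import Data.Product using (_×_; ∃-syntax)
open import Relation.Binary.PropositionalEquality using (_≡_)
open import Relation.Nullary using (¬_)

open import Data.Empty using (⊥-elim)
open import Data.Fin using (toℕ)
open import Data.Fin.Properties using (toℕ-fromℕ<)
open import Data.List using (_∷_; [])
open import Data.Nat using (zero; suc; _+_; _*_; _^_; _<_; _%_; _/_; NonZero; >-nonZero; z≤n; s≤s)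
open import Data.Nat.DivMod using (_mod_; m≡m%n+[m/n]*n; m%n<n)
open import Data.Nat.Logarithm using (⌊log₂_⌋; ⌊log₂⌋-mono-≤; ⌊log₂[2*b]⌋≡1+⌊log₂b⌋)
open import Data.Nat.Properties
open import Algebra.Properties.CommutativeSemigroup +-commutativeSemigroup using (x∙yz≈y∙xz)
open import Data.Nat.Tactic.RingSolver using (solve)
open import Data.Product using (_,_)
open import Data.Sum using (_⊎_; inj₁; inj₂)
open import Relation.Binary.PropositionalEquality using (refl; sym; trans; cong; module ≡-Reasoning)

n<2^n : ∀ n → n < 2 ^ n
n<2^n zero    = s≤s z≤n
n<2^n (suc n) = +-mono-≤ (≤-trans (s≤s z≤n) ih) (≤-trans ih (m≤m+n (2 ^ n) 0))
  where ih = n<2^n n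

m%n≡o%n∧m<o⇒n+m≤o : ∀ n .{{_ : NonZero n}} {m o} → m % n ≡ o % n → m < o → n + m ≤ o
m%n≡o%n∧m<o⇒n+m≤o n {m} {o} m%n≡o%n m<o = begin
  n + m                     ≡⟨ cong (n +_) (m≡m%n+[m/n]*n m n) ⟩
  n + (m % n + m / n * n)   ≡⟨ x∙yz≈y∙xz n (m % n) (m / n * n) ⟩
  m % n + suc (m / n) * n   ≤⟨ +-mono-≤ (≤-reflexive m%n≡o%n) (*-monoˡ-≤ n quotient<) ⟩
  o % n + o / n * n         ≡⟨ sym (m≡m%n+[m/n]*n o n) ⟩
  o                         ∎
  where
  open ≤-Reasoning
  quotient< : m / n < o / n
  quotient< = *-cancelʳ-< n (m / n) (o / n) (+-cancelˡ-< (o % n) _ _ (begin-strict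
    o % n + m / n * n  ≡⟨ cong (_+ m / n * n) (sym m%n≡o%n) ⟩
    m % n + m / n * n  ≡⟨ sym (m≡m%n+[m/n]*n m n) ⟩
    m                  <⟨ m<o ⟩
    o                  ≡⟨ m≡m%n+[m/n]*n o n ⟩
    o % n + o / n * n  ∎))

⌊log₂[2^k*n]⌋≡k+⌊log₂n⌋ : ∀ k n .{{_ : NonZero n}} → ⌊log₂ (2 ^ k * n) ⌋ ≡ k + ⌊log₂ n ⌋
⌊log₂[2^k*n]⌋≡k+⌊log₂n⌋ zero    n = cong ⌊log₂_⌋ (+-identityʳ n)
⌊log₂[2^k*n]⌋≡k+⌊log₂n⌋ (suc k) n = begin
  ⌊log₂ (2 * 2 ^ k * n) ⌋    ≡⟨ cong ⌊log₂_⌋ (*-assoc 2 (2 ^ k) n) ⟩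
  ⌊log₂ (2 * (2 ^ k * n)) ⌋  ≡⟨ ⌊log₂[2*b]⌋≡1+⌊log₂b⌋ (2 ^ k * n) {{m*n≢0 (2 ^ k) n {{m^n≢0 2 k}}}} ⟩
  suc ⌊log₂ (2 ^ k * n) ⌋    ≡⟨ cong suc (⌊log₂[2^k*n]⌋≡k+⌊log₂n⌋ k n) ⟩
  suc (k + ⌊log₂ n ⌋)        ∎
  where open ≡-Reasoning

level : ℕ → ℕ
level n = ⌊log₂ (n * n) ⌋

level-mono-≤ : ∀ {m n} → m ≤ n → level m ≤ level n
level-mono-≤ m≤n = ⌊log₂⌋-mono-≤ (*-mono-≤ m≤n m≤n)

level-cancel-< : ∀ {m n} → level m < level n → m < n
level-cancel-< lm<ln = ≰⇒> (λ n≤m → <⇒≱ lm<ln (level-mono-≤ n≤m))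

level[2^k*n]≡k+k+level[n] : ∀ k n .{{_ : NonZero n}} → level (2 ^ k * n) ≡ k + k + level n
level[2^k*n]≡k+k+level[n] k n = begin
  ⌊log₂ (2 ^ k * n * (2 ^ k * n)) ⌋  ≡⟨ cong ⌊log₂_⌋ square ⟩
  ⌊log₂ (2 ^ (k + k) * (n * n)) ⌋    ≡⟨ ⌊log₂[2^k*n]⌋≡k+⌊log₂n⌋ (k + k) (n * n) {{m*n≢0 n n}} ⟩
  k + k + level n                    ∎
  where
  open ≡-Reasoning
  square : 2 ^ k * n * (2 ^ k * n) ≡ 2 ^ (k + k) * (n * n)
  square = trans ([p*n]²≡p²*n² (2 ^ k) n) (cong (_* (n * n)) (sym (^-distribˡ-+-* 2 k k)))
    where
    [p*n]²≡p²*n² : ∀ p n → p * n * (p * n) ≡ p * p * (n * n)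
    [p*n]²≡p²*n² p n = solve (p ∷ n ∷ [])

-- (3/2)² > 2
3*m≤2*n⇒level[m]<level[n] : ∀ {m n} .{{_ : NonZero m}} → 3 * m ≤ 2 * n → level m < level n
3*m≤2*n⇒level[m]<level[n] {m} {n} 3m≤2n = begin-strict
  level m                    <⟨ n<1+n (level m) ⟩
  suc (level m)              ≡⟨ sym (⌊log₂[2*b]⌋≡1+⌊log₂b⌋ (m * m) {{m*n≢0 m m}}) ⟩
  ⌊log₂ (2 * (m * m)) ⌋      ≤⟨ ⌊log₂⌋-mono-≤ (*-cancelˡ-≤ {2 * (m * m)} {n * n} 4 squares) ⟩
  level n                    ∎
  where
  open ≤-Reasoning
  squares : 4 * (2 * (m * m)) ≤ 4 * (n * n)
  squares = begin
    4 * (2 * (m * m))  ≡⟨ solve (m ∷ []) ⟩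
    8 * (m * m)        ≤⟨ m≤n+m (8 * (m * m)) (m * m) ⟩
    9 * (m * m)        ≡⟨ solve (m ∷ []) ⟩
    3 * m * (3 * m)    ≤⟨ *-mono-≤ 3m≤2n 3m≤2n ⟩
    2 * n * (2 * n)    ≡⟨ solve (n ∷ []) ⟩
    4 * (n * n)        ∎

levelColouring : ∀ r .{{_ : NonZero r}} → Coloring r
levelColouring r n = level n mod r

levelColouring-≡∧level<⇒r+level≤level : ∀ r .{{_ : NonZero r}} {m n} →
  levelColouring r m ≡ levelColouring r n → level m < level n → r + level m ≤ level n
levelColouring-≡∧level<⇒r+level≤level r {m} {n} same = m%n≡o%n∧m<o⇒n+m≤o r (begin
  level m % r               ≡⟨ sym (toℕ-fromℕ< (m%n<n (level m) r)) ⟩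
  toℕ (levelColouring r m)  ≡⟨ cong toℕ same ⟩
  toℕ (levelColouring r n)  ≡⟨ toℕ-fromℕ< (m%n<n (level n) r) ⟩
  level n % r               ∎)
  where open ≡-Reasoning

levelColouring-≡∧3*m≤2*n⇒2^k*m<n : ∀ k {m n} .{{_ : NonZero m}} →
  levelColouring (suc (k + k)) m ≡ levelColouring (suc (k + k)) n → 3 * m ≤ 2 * n → 2 ^ k * m < n
levelColouring-≡∧3*m≤2*n⇒2^k*m<n k {m} {n} same 3m≤2n = level-cancel-< (begin-strict
  level (2 ^ k * m)  ≡⟨ level[2^k*n]≡k+k+level[n] k m ⟩
  k + k + level m    <⟨ levelColouring-≡∧level<⇒r+level≤level (suc (k + k)) {m} {n} same
                                (3*m≤2*n⇒level[m]<level[n] {m} {n} 3m≤2n) ⟩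
  level n            ∎)
  where open ≤-Reasoning

b*x+2*d≤b*[a*x+d] : ∀ a b x d → 1 ≤ a → 2 ≤ b → b * x + 2 * d ≤ b * (a * x + d)
b*x+2*d≤b*[a*x+d] a b x d 1≤a 2≤b = begin
  b * x + 2 * d        ≤⟨ +-mono-≤ (*-monoʳ-≤ b (m≤n*m x a {{>-nonZero 1≤a}})) (*-monoˡ-≤ d 2≤b) ⟩
  b * (a * x) + b * d  ≡⟨ sym (*-distribˡ-+ b (a * x) d) ⟩
  b * (a * x + d)      ∎
  where open ≤-Reasoning

3*x≤2*[a*x+d] : ∀ a x d → 2 ≤ a → 3 * x ≤ 2 * (a * x + d)
3*x≤2*[a*x+d] a x d 2≤a = begin
  3 * x            ≤⟨ *-monoˡ-≤ x (≤-trans (n≤1+n 3) (*-monoʳ-≤ 2 2≤a)) ⟩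
  2 * a * x        ≡⟨ *-assoc 2 a x ⟩
  2 * (a * x)      ≤⟨ *-monoʳ-≤ 2 (m≤m+n (a * x) d) ⟩
  2 * (a * x + d)  ∎
  where open ≤-Reasoning

3*[a*x+d]≤2*[b*x+2*d]-wide : ∀ a b x d → 2 * a ≤ b → 3 * (a * x + d) ≤ 2 * (b * x + 2 * d)
3*[a*x+d]≤2*[b*x+2*d]-wide a b x d 2a≤b = begin
  3 * (a * x + d)          ≤⟨ m≤n+m (3 * (a * x + d)) (a * x + d) ⟩
  4 * (a * x + d)          ≡⟨ solve (a ∷ x ∷ d ∷ []) ⟩
  2 * (2 * a * x + 2 * d)  ≤⟨ *-monoʳ-≤ 2 (+-monoˡ-≤ (2 * d) (*-monoˡ-≤ x 2a≤b)) ⟩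
  2 * (b * x + 2 * d)      ∎
  where open ≤-Reasoning

3*[a*x+d]≤2*[b*x+2*d]-sparse : ∀ a b x d → a ≤ b → 2 * a * x ≤ a * x + d →
  3 * (a * x + d) ≤ 2 * (b * x + 2 * d)
3*[a*x+d]≤2*[b*x+2*d]-sparse a b x d a≤b sparse = +-cancelʳ-≤ (a * x + d) _ _ (begin
  3 * (a * x + d) + (a * x + d)      ≡⟨ solve (a ∷ x ∷ d ∷ []) ⟩
  2 * a * x + 2 * (a * x + 2 * d)    ≤⟨ +-mono-≤ sparse (*-monoʳ-≤ 2 (+-monoˡ-≤ (2 * d) (*-monoˡ-≤ x a≤b))) ⟩
  a * x + d + 2 * (b * x + 2 * d)    ≡⟨ +-comm (a * x + d) (2 * (b * x + 2 * d)) ⟩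
  2 * (b * x + 2 * d) + (a * x + d)  ∎)
  where open ≤-Reasoning

2*a≤b⊎2≤a : ∀ {a b} → 1 ≤ a → a ≤ b → ¬ ((a ≡ 1) × (b ≡ 1)) → 2 * a ≤ b ⊎ 2 ≤ a
2*a≤b⊎2≤a {zero}        ()
2*a≤b⊎2≤a {suc zero}    {zero}        _ ()
2*a≤b⊎2≤a {suc zero}    {suc zero}    _ _ ≢11 = ⊥-elim (≢11 (refl , refl))
2*a≤b⊎2≤a {suc zero}    {suc (suc b)} _ _ _   = inj₁ (s≤s (s≤s z≤n))
2*a≤b⊎2≤a {suc (suc a)}               _ _ _   = inj₂ (s≤s (s≤s z≤n))

levelColouring-avoids-triples : ∀ {a b} → 1 ≤ a → a ≤ b → 2 * a ≤ b ⊎ 2 ≤ a →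
  ¬ AdmitsMono a b (levelColouring (suc (suc b + suc b)))
levelColouring-avoids-triples {a} {b} 1≤a a≤b regime (x , d , x≥1 , d≥1 , cx≡cy , cx≡cz) =
  <⇒≱ (levelColouring-≡∧3*m≤2*n⇒2^k*m<n k {y} {z} (trans (sym cx≡cy) cx≡cz) (3y≤2z regime)) z≤2^k*y
  where
  k = suc b
  y = a * x + d
  z = b * x + 2 * d
  instance
    x≢0 : NonZero x
    x≢0 = >-nonZero x≥1
    y≢0 : NonZero y
    y≢0 = >-nonZero (≤-trans d≥1 (m≤n+m d (a * x)))

  2*b≤2^k : 2 * b ≤ 2 ^ k
  2*b≤2^k = *-monoʳ-≤ 2 (<⇒≤ (n<2^n b))

  2≤b : 2 * a ≤ b ⊎ 2 ≤ a → 2 ≤ b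
  2≤b (inj₁ 2a≤b) = ≤-trans (*-monoʳ-≤ 2 1≤a) 2a≤b
  2≤b (inj₂ 2≤a)  = ≤-trans 2≤a a≤b

  z≤2^k*y : z ≤ 2 ^ k * y
  z≤2^k*y = ≤-trans (b*x+2*d≤b*[a*x+d] a b x d 1≤a (2≤b regime))
                    (*-monoˡ-≤ y (≤-trans (m≤m+n b (b + 0)) 2*b≤2^k))

  3y≤2z : 2 * a ≤ b ⊎ 2 ≤ a → 3 * y ≤ 2 * z
  3y≤2z (inj₁ 2a≤b) = 3*[a*x+d]≤2*[b*x+2*d]-wide a b x d 2a≤b
  3y≤2z (inj₂ 2≤a)  = 3*[a*x+d]≤2*[b*x+2*d]-sparse a b x d a≤b (begin
    2 * a * x  ≤⟨ *-monoˡ-≤ x (≤-trans (*-monoʳ-≤ 2 a≤b) 2*b≤2^k) ⟩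
    2 ^ k * x  <⟨ levelColouring-≡∧3*m≤2*n⇒2^k*m<n k {x} {y} cx≡cy (3*x≤2*[a*x+d] a x d 2≤a) ⟩
    y          ∎)
    where open ≤-Reasoning

theorem1 : (a b : ℕ) → 1 ≤ a → a ≤ b → ¬ ((a ≡ 1) × (b ≡ 1)) →
           ∃[ r ] ∃[ c ] ¬ AdmitsMono {r} a b c
theorem1 a b 1≤a a≤b ≢11 =
  _ , levelColouring _ , levelColouring-avoids-triples 1≤a a≤b (2*a≤b⊎2≤a 1≤a a≤b ≢11)
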